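{- Let $G$ be a finite simple graph without leaves (no vertex of degree $1$), with $n$ vertices, and let $f$ be a strongly antimagic labeling of $G$, with vertices ordered $v_1,\ldots,v_n$ so that $\phi_f(v_1)<\cdots<\phi_f(v_n)$. Suppose $j$ satisfies either $\deg(v_j)\leqslant\deg(v_{j+1})-2$ or $j=n$. Then for any integer $k\geqslant 3$, the graph $G^*$ obtained from $G$ by attaching a $k$-cycle to $v_j$ (i.e. adding $k-1$ new vertices which together with $v_j$ form a new cycle of length $k$) is strongly antimagic.
   Context: For a graph with $m$ edges, an antimagic labeling is a bijection $f:E\to\{1,\ldots,m\}$ such that the vertex sums $\phi_f(x)=\sum_{e\ni x}f(e)$ are pairwise distinct. A strongly antimagic labeling is an antimagic labeling with $\phi_f(x)>\phi_f(y)$ whenever $\deg(x)>\deg(y)$. A graph is strongly antimagic if it admits one. -}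

module Defs where

open import Data.Nat using (ℕ; zero; suc; _+_; _∸_; _≤_; _<_; s≤s)
open import Data.Fin as Fin using (Fin; zero; suc; toℕ; _↑ˡ_; _↑ʳ_; splitAt)
open import Data.Fin.Properties using (_≟_)
open import Data.Bool using (Bool; true; false; _∨_; if_then_else_)
open import Data.Maybe using (Maybe; just; nothing; maybe)
import Data.Maybe as Maybe
open import Data.Product using (_×_; _,_; proj₁; proj₂; ∃)
open import Data.Sum using (_⊎_; inj₁; inj₂)
open import Relation.Nullary using (does; ¬_)
open import Relation.Binary.PropositionalEquality using (_≡_)
open import Function.Definitions using (Injective; Bijective)

Graph : ℕ → ℕ → Set
Graph n m = Fin m → Fin n × Fin n

-- Simple graph: endpoints stored in increasing order (so no loops, and the
-- pair is a canonical representative of the unordered edge) and distinct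
-- edges have distinct endpoint pairs (no multiple edges).
IsSimple : ∀ {n m} → Graph n m → Set
IsSimple G = (∀ e → proj₁ (G e) Fin.< proj₂ (G e)) × Injective _≡_ _≡_ G

Σᶠ : ∀ {m} → (Fin m → ℕ) → ℕ
Σᶠ {zero}  g = 0
Σᶠ {suc m} g = g zero + Σᶠ (λ i → g (suc i))

incident : ∀ {n m} → Graph n m → Fin n → Fin m → Bool
incident G x e = does (proj₁ (G e) ≟ x) ∨ does (proj₂ (G e) ≟ x)

deg : ∀ {n m} → Graph n m → Fin n → ℕ
deg G x = Σᶠ (λ e → if incident G x e then 1 else 0)

-- A labeling is a bijection f : E → Fin m; the label of e is 1 + toℕ (f e),
-- so the labels form exactly {1,…,m}.
label : ∀ {m} → (Fin m → Fin m) → Fin m → ℕ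
label f e = suc (toℕ (f e))

φ : ∀ {n m} → Graph n m → (Fin m → Fin m) → Fin n → ℕ
φ G f x = Σᶠ (λ e → if incident G x e then label f e else 0)

IsAntimagicLabeling : ∀ {n m} → Graph n m → (Fin m → Fin m) → Set
IsAntimagicLabeling G f = Bijective _≡_ _≡_ f × Injective _≡_ _≡_ (φ G f)

IsStronglyAntimagicLabeling : ∀ {n m} → Graph n m → (Fin m → Fin m) → Set
IsStronglyAntimagicLabeling G f =
  IsAntimagicLabeling G f × (∀ x y → deg G y < deg G x → φ G f y < φ G f x)

StronglyAntimagic : ∀ {n m} → Graph n m → Set
StronglyAntimagic {m = m} G = ∃ λ (f : Fin m → Fin m) → IsStronglyAntimagicLabeling G f

next : ∀ {s} → Fin (suc s) → Maybe (Fin (suc s))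
next {zero}  zero    = nothing
next {suc s} zero    = just (suc zero)
next {suc s} (suc i) = Maybe.map suc (next i)

-- the k = s+2 edges of the cycle v, w₀, w₁, …, w_s, v where the new
-- vertices are w_i = n + i
cycleEdges : ∀ {n} s → Fin n → Fin (suc (suc s)) → Fin (n + suc s) × Fin (n + suc s)
cycleEdges {n} s v zero    = (v ↑ˡ suc s) , (n ↑ʳ zero)
cycleEdges {n} s v (suc i) = (n ↑ʳ i) , maybe (λ j → n ↑ʳ j) (v ↑ˡ suc s) (next i)

-- G* : attach a k-cycle at vertex v (k - 1 new vertices n, …, n+k-2;
-- old edges keep their indices 0..m-1, the k new edges are m..m+k-1).
attachCycle : ∀ {n m} → Graph n m → Fin n → (k : ℕ) → 3 ≤ k →
              Graph (n + (k ∸ 1)) (m + k)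
attachCycle {n} {m} G v (suc (suc (suc r))) (s≤s (s≤s (s≤s _))) e with splitAt m e
... | inj₁ old = (proj₁ (G old) ↑ˡ suc (suc r)) , (proj₂ (G old) ↑ˡ suc (suc r))
... | inj₂ new = cycleEdges (suc r) v new

{-# OPTIONS --safe #-}
module Submission where

open import Defs
open import Data.Bool using (true; false; _∨_; if_then_else_)
open import Data.Empty using (⊥-elim)
open import Data.Fin using (Fin; zero; suc; toℕ; fromℕ; fromℕ<; inject₁; _↑ˡ_; _↑ʳ_; splitAt; join)
open import Data.Fin.Permutation using (Permutation′; transpose; id; cast-id)
open import Data.Fin.Properties
  using ( _≟_; toℕ-injective; toℕ<n; toℕ-fromℕ; toℕ-fromℕ<; toℕ-inject₁; toℕ-cast; toℕ-↑ˡ; toℕ-↑ʳ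
        ; ↑ˡ-injective; ↑ʳ-injective; splitAt-↑ˡ; splitAt-↑ʳ; join-splitAt; +↔⊎)
  renaming (suc-injective to suc-injective′)
open import Data.Fin.Relation.Unary.Top using (view; ‵fromℕ; ‵inject₁)
open import Data.Maybe using (just; nothing; maybe)
import Data.Maybe as Maybe
open import Data.Nat as ℕ using (ℕ; zero; suc; _+_; _*_; _≤_; _<_; z≤n; s≤s)
open import Data.Nat.Properties hiding (_≟_)
open import Algebra.Properties.CommutativeSemigroup +-commutativeSemigroup using (interchange; xy∙z≈xz∙y)
open import Data.Nat.Tactic.RingSolver using (solve-∀)
open import Data.Product using (Σ; _×_; _,_; proj₁; proj₂)
open import Data.Sum using (_⊎_; inj₁; inj₂)
open import Data.Sum.Function.Propositional using (_⊎-cong_)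
open import Data.Sum.Properties using (swap-↔)
open import Function using (_∘_)
open import Function.Bundles using (Inverse; Bijection; _⇔_; mk⇔; mk⤖)
open import Function.Definitions using (Injective; Surjective; Bijective)
open import Function.Properties.Bijection using (⤖⇒↔)
open import Function.Properties.Inverse using (↔-sym; ↔-trans; Inverse⇒Bijection)
open import Relation.Binary.Definitions using (tri<; tri≈; tri>)
open import Relation.Binary.PropositionalEquality
open import Relation.Nullary using (¬_; does; yes; no)
open import Relation.Nullary.Decidable using (dec-false; does-⇔)

-- Label the k cycle edges by 1, …, k so that the k vertex sums around the cycle are
-- pairwise distinct, and give each old edge e the label k + f(e). An old vertex x ≠ v then
-- has vertex sum k·deg(x) + φ(x), the root v has k·deg(v) + φ(v) plus at most 2k from its
-- two cycle edges, and each new vertex has degree 2 and sum at most 2k. As f is strongly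
-- antimagic, k·deg + φ increases along the φ-order of the old vertices; the surplus of at
-- most 2k at v stays below the next vertex because its degree is at least deg(v) + 2.
-- Without leaves, an old vertex of positive degree has degree at least 2 and sum above 2k,
-- while isolated ones have sum 0, so the new vertices fit in between.

Σᶠ-cong : ∀ {N} {g h : Fin N → ℕ} → (∀ t → g t ≡ h t) → Σᶠ g ≡ Σᶠ h
Σᶠ-cong {zero}  g≡h = refl
Σᶠ-cong {suc N} g≡h = cong₂ _+_ (g≡h zero) (Σᶠ-cong (g≡h ∘ suc))

Σᶠ-mono : ∀ {N} {g h : Fin N → ℕ} → (∀ t → g t ≤ h t) → Σᶠ g ≤ Σᶠ h
Σᶠ-mono {zero}  g≤h = z≤n
Σᶠ-mono {suc N} g≤h = +-mono-≤ (g≤h zero) (Σᶠ-mono (g≤h ∘ suc))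

Σᶠ-zero : ∀ {N} {g : Fin N → ℕ} → (∀ t → g t ≡ 0) → Σᶠ g ≡ 0
Σᶠ-zero {zero}  g≡0 = refl
Σᶠ-zero {suc N} g≡0 = cong₂ _+_ (g≡0 zero) (Σᶠ-zero (g≡0 ∘ suc))

Σᶠ-+ : ∀ {N} (g h : Fin N → ℕ) → Σᶠ (λ t → g t + h t) ≡ Σᶠ g + Σᶠ h
Σᶠ-+ {zero}  g h = refl
Σᶠ-+ {suc N} g h = trans (cong (g zero + h zero +_) (Σᶠ-+ (g ∘ suc) (h ∘ suc)))
                         (interchange (g zero) (h zero) _ _)

Σᶠ-*ˡ : ∀ {N} a (g : Fin N → ℕ) → Σᶠ (λ t → a * g t) ≡ a * Σᶠ g
Σᶠ-*ˡ {zero}  a g = sym (*-zeroʳ a)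
Σᶠ-*ˡ {suc N} a g = trans (cong (a * g zero +_) (Σᶠ-*ˡ a (g ∘ suc)))
                          (sym (*-distribˡ-+ a (g zero) _))

Σᶠ-split : ∀ a b (g : Fin (a + b) → ℕ) → Σᶠ g ≡ Σᶠ (g ∘ (_↑ˡ b)) + Σᶠ (g ∘ (a ↑ʳ_))
Σᶠ-split zero    b g = refl
Σᶠ-split (suc a) b g = trans (cong (g zero +_) (Σᶠ-split a b (g ∘ suc)))
                             (sym (+-assoc (g zero) _ _))

Σᶠ-δ : ∀ {N} (a : Fin N) (h : Fin N → ℕ) → Σᶠ (λ t → if does (t ≟ a) then h t else 0) ≡ h a
Σᶠ-δ {suc N} zero    h =
  trans (cong (h zero +_) (Σᶠ-zero {N} {λ _ → 0} (λ _ → refl))) (+-identityʳ (h zero))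
Σᶠ-δ {suc N} (suc a) h = Σᶠ-δ a (h ∘ suc)

Σᶠ-δ∨δ : ∀ {N} {a b : Fin N} (h : Fin N → ℕ) → a ≢ b →
         Σᶠ (λ t → if does (t ≟ a) ∨ does (t ≟ b) then h t else 0) ≡ h a + h b
Σᶠ-δ∨δ {a = a} {b} h a≢b = begin
  Σᶠ (λ t → if does (t ≟ a) ∨ does (t ≟ b) then h t else 0)
    ≡⟨ Σᶠ-cong if-∨ ⟩
  Σᶠ (λ t → (if does (t ≟ a) then h t else 0) + (if does (t ≟ b) then h t else 0))
    ≡⟨ Σᶠ-+ (λ t → if does (t ≟ a) then h t else 0) (λ t → if does (t ≟ b) then h t else 0) ⟩
  Σᶠ (λ t → if does (t ≟ a) then h t else 0) + Σᶠ (λ t → if does (t ≟ b) then h t else 0)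
    ≡⟨ cong₂ _+_ (Σᶠ-δ a h) (Σᶠ-δ b h) ⟩
  h a + h b ∎
  where
  open ≡-Reasoning
  if-∨ : ∀ t → (if does (t ≟ a) ∨ does (t ≟ b) then h t else 0)
               ≡ (if does (t ≟ a) then h t else 0) + (if does (t ≟ b) then h t else 0)
  if-∨ t with t ≟ a | t ≟ b
  ... | yes refl | yes refl = ⊥-elim (a≢b refl)
  ... | yes _    | no _     = sym (+-identityʳ (h t))
  ... | no _     | _        = refl

incidentSum : ∀ {n m} → Graph n m → Fin n → (Fin m → ℕ) → ℕ
incidentSum G x h = Σᶠ (λ e → if incident G x e then h e else 0)

module _ {n m} (G : Graph n m) (x : Fin n) where

  incidentSum-cong : ∀ {g h} → (∀ e → g e ≡ h e) → incidentSum G x g ≡ incidentSum G x h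
  incidentSum-cong g≡h = Σᶠ-cong (λ e → cong (if incident G x e then_else 0) (g≡h e))

  incidentSum-+ : ∀ a h → incidentSum G x (λ e → a + h e) ≡ a * deg G x + incidentSum G x h
  incidentSum-+ a h = begin
    incidentSum G x (λ e → a + h e)
      ≡⟨ Σᶠ-cong split ⟩
    Σᶠ (λ e → a * (if incident G x e then 1 else 0) + (if incident G x e then h e else 0))
      ≡⟨ Σᶠ-+ (λ e → a * (if incident G x e then 1 else 0)) (λ e → if incident G x e then h e else 0) ⟩
    Σᶠ (λ e → a * (if incident G x e then 1 else 0)) + incidentSum G x h
      ≡⟨ cong (_+ incidentSum G x h) (Σᶠ-*ˡ a (λ e → if incident G x e then 1 else 0)) ⟩
    a * deg G x + incidentSum G x h ∎
    where
    open ≡-Reasoning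
    split : ∀ e → (if incident G x e then a + h e else 0)
                  ≡ a * (if incident G x e then 1 else 0) + (if incident G x e then h e else 0)
    split e with incident G x e
    ... | true  = cong (_+ h e) (sym (*-identityʳ a))
    ... | false = cong (_+ 0) (sym (*-zeroʳ a))

  deg≤φ : ∀ f → deg G x ≤ φ G f x
  deg≤φ f = Σᶠ-mono (λ e → one≤label (incident G x e) e)
    where
    one≤label : ∀ b e → (if b then 1 else 0) ≤ (if b then label f e else 0)
    one≤label true  e = s≤s z≤n
    one≤label false e = z≤n

  φ≤m*deg : ∀ f → φ G f x ≤ m * deg G x
  φ≤m*deg f = ≤-trans (Σᶠ-mono (λ e → label≤m (incident G x e) e))
                      (≤-reflexive (Σᶠ-*ˡ m (λ e → if incident G x e then 1 else 0)))
    where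
    label≤m : ∀ b e → (if b then label f e else 0) ≤ m * (if b then 1 else 0)
    label≤m true  e = ≤-trans (toℕ<n (f e)) (≤-reflexive (sym (*-identityʳ m)))
    label≤m false e = ≤-reflexive (sym (*-zeroʳ m))

  deg≡0⇒φ≡0 : ∀ f → deg G x ≡ 0 → φ G f x ≡ 0
  deg≡0⇒φ≡0 f deg≡0 = n≤0⇒n≡0 (≤-trans (φ≤m*deg f) (≤-reflexive (trans (cong (m *_) deg≡0) (*-zeroʳ m))))

module _ {A : Set} (Φ D : A → ℕ) where

  strong⇒monotone : (∀ x y → D y < D x → Φ y < Φ x) → ∀ x y → Φ x < Φ y → D x ≤ D y
  strong⇒monotone strong x y Φx<Φy = ≮⇒≥ (λ Dy<Dx → <-asym (strong x y Dy<Dx) Φx<Φy)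

  monotone⇒strong : Injective _≡_ _≡_ Φ → (∀ x y → Φ x < Φ y → D x ≤ D y) →
                    ∀ x y → D y < D x → Φ y < Φ x
  monotone⇒strong Φ-inj mono x y Dy<Dx with <-cmp (Φ y) (Φ x)
  ... | tri< Φy<Φx _ _ = Φy<Φx
  ... | tri≈ _ Φy≡Φx _ = ⊥-elim (<-irrefl (cong D (Φ-inj Φy≡Φx)) Dy<Dx)
  ... | tri> _ _ Φx<Φy = ⊥-elim (<⇒≱ Dy<Dx (mono x y Φx<Φy))

DegreeGapAbove : ∀ {n m} → Graph n m → (Fin m → Fin m) → Fin n → Set
DegreeGapAbove G f v = ∀ y → φ G f v < φ G f y → deg G v + 2 ≤ deg G y

module _ {n m} (G : Graph n m) (f : Fin m → Fin m)
         (strong : ∀ x y → deg G y < deg G x → φ G f y < φ G f x)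
         (ord : Fin n → Fin n) (ord-surj : Surjective _≡_ _≡_ ord)
         (ord-mono : ∀ i i′ → toℕ i < toℕ i′ → φ G f (ord i) < φ G f (ord i′)) where

  private
    ord-reflects-< : ∀ {i i′} → φ G f (ord i) < φ G f (ord i′) → toℕ i < toℕ i′
    ord-reflects-< {i} {i′} φ< with <-cmp (toℕ i) (toℕ i′)
    ... | tri< i<i′ _ _ = i<i′
    ... | tri≈ _ i≡i′ _ = ⊥-elim (<-irrefl (cong (φ G f ∘ ord) (toℕ-injective i≡i′)) φ<)
    ... | tri> _ _ i′<i = ⊥-elim (<-asym φ< (ord-mono i′ i i′<i))

    deg-ord-mono : ∀ {i i′} → toℕ i ≤ toℕ i′ → deg G (ord i) ≤ deg G (ord i′)
    deg-ord-mono {i} {i′} i≤i′ with m≤n⇒m<n∨m≡n i≤i′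
    ... | inj₁ i<i′ = strong⇒monotone (φ G f) (deg G) strong (ord i) (ord i′) (ord-mono i i′ i<i′)
    ... | inj₂ i≡i′ = ≤-reflexive (cong (deg G ∘ ord) (toℕ-injective i≡i′))

  GapAfter : Fin n → Set
  GapAfter j = suc (toℕ j) ≡ n ⊎ (∀ j′ → toℕ j′ ≡ suc (toℕ j) → deg G (ord j) + 2 ≤ deg G (ord j′))

  private
    gap-later : ∀ {j i} → GapAfter j → toℕ j < toℕ i → deg G (ord j) + 2 ≤ deg G (ord i)
    gap-later {j} {i} (inj₁ 1+j≡n) j<i = ⊥-elim (<⇒≱ (toℕ<n i) (subst (_≤ toℕ i) 1+j≡n j<i))
    gap-later {j} {i} (inj₂ gap) j<i =
      ≤-trans (gap (fromℕ< 1+j<n) (toℕ-fromℕ< 1+j<n))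
              (deg-ord-mono (subst (_≤ toℕ i) (sym (toℕ-fromℕ< 1+j<n)) j<i))
      where
      1+j<n : suc (toℕ j) < n
      1+j<n = ≤-<-trans j<i (toℕ<n i)

  degreeGapAbove : ∀ {j} → GapAfter j → DegreeGapAbove G f (ord j)
  degreeGapAbove gap y with i , ord-i≡y ← ord-surj y with refl ← ord-i≡y refl =
    gap-later gap ∘ ord-reflects-<

next-fromℕ : ∀ s → next (fromℕ s) ≡ nothing
next-fromℕ zero    = refl
next-fromℕ (suc s) = cong (Maybe.map suc) (next-fromℕ s)

next-inject₁ : ∀ {s} (i : Fin s) → next (inject₁ i) ≡ just (suc i)
next-inject₁ {suc s} zero    = refl
next-inject₁ {suc s} (suc i) = cong (Maybe.map suc) (next-inject₁ i)

cycleSucc : ∀ {s} → Fin (suc (suc s)) → Fin (suc (suc s))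
cycleSucc zero    = suc zero
cycleSucc (suc i) = maybe suc zero (next i)

cyclePred : ∀ {k} → Fin (suc k) → Fin (suc k)
cyclePred zero    = fromℕ _
cyclePred (suc i) = inject₁ i

cycleSucc-cyclePred : ∀ {s} (a : Fin (suc (suc s))) → cycleSucc (cyclePred a) ≡ a
cycleSucc-cyclePred {s} zero = cong (maybe suc zero) (next-fromℕ s)
cycleSucc-cyclePred (suc zero)    = refl
cycleSucc-cyclePred (suc (suc i)) = cong (maybe suc zero) (next-inject₁ i)

cyclePred-cycleSucc : ∀ {s} (t : Fin (suc (suc s))) → cyclePred (cycleSucc t) ≡ t
cyclePred-cycleSucc zero = refl
cyclePred-cycleSucc {s} (suc i) with view i
... | ‵fromℕ     = cong (cyclePred ∘ maybe suc zero) (next-fromℕ s)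
... | ‵inject₁ j = cong (cyclePred ∘ maybe suc zero) (next-inject₁ j)

cycleSucc≡⇔ : ∀ {s} {t a : Fin (suc (suc s))} → (cycleSucc t ≡ a) ⇔ (t ≡ cyclePred a)
cycleSucc≡⇔ {t = t} {a} = mk⇔ (λ { refl → sym (cyclePred-cycleSucc t) })
                              (λ { refl → cycleSucc-cyclePred a })

cyclePred-≢ : ∀ {s} (a : Fin (suc (suc s))) → a ≢ cyclePred a
cyclePred-≢ zero    ()
cyclePred-≢ (suc i) eq = 1+n≢n (trans (cong toℕ eq) (toℕ-inject₁ i))

does-injective : ∀ {N M} {g : Fin N → Fin M} → Injective _≡_ _≡_ g →
                 ∀ a b → does (g a ≟ g b) ≡ does (a ≟ b)
does-injective {g = g} g-inj a b = does-⇔ (mk⇔ g-inj (cong g)) (g a ≟ g b) (a ≟ b)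

↑ˡ≢↑ʳ : ∀ {a b} (i : Fin a) (j : Fin b) → i ↑ˡ b ≢ a ↑ʳ j
↑ˡ≢↑ʳ {a} {b} i j eq = <⇒≱ (toℕ<n i) (begin
  a                ≤⟨ m≤m+n a (toℕ j) ⟩
  a + toℕ j        ≡⟨ toℕ-↑ʳ a j ⟨
  toℕ (a ↑ʳ j)     ≡⟨ cong toℕ eq ⟨
  toℕ (i ↑ˡ b)     ≡⟨ toℕ-↑ˡ i b ⟩
  toℕ i            ∎)
  where open ≤-Reasoning

incident-≡ : ∀ {n m} (G : Graph n m) x e {a b} → G e ≡ (a , b) →
             incident G x e ≡ does (a ≟ x) ∨ does (b ≟ x)
incident-≡ G x e eq = cong (λ ab → does (proj₁ ab ≟ x) ∨ does (proj₂ ab ≟ x)) eq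

incident-false : ∀ {n m} (G : Graph n m) x e {a b} → G e ≡ (a , b) → a ≢ x → b ≢ x →
                 incident G x e ≡ false
incident-false G x e {a} {b} eq a≢x b≢x =
  trans (incident-≡ G x e eq) (cong₂ _∨_ (dec-false (a ≟ x) a≢x) (dec-false (b ≟ x) b≢x))

data Split {a b} : Fin (a + b) → Set where
  left  : ∀ i → Split (i ↑ˡ b)
  right : ∀ j → Split (a ↑ʳ j)

split : ∀ {a b} (e : Fin (a + b)) → Split e
split {a} {b} e = subst (Split {a} {b}) (join-splitAt a b e) (split′ (splitAt a e))
  where
  split′ : (z : Fin a ⊎ Fin b) → Split {a} {b} (join a b z)
  split′ (inj₁ i) = left i
  split′ (inj₂ j) = right {a} j

module AttachedCycle {n m} (G : Graph n m) (v : Fin n) (r : ℕ) where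

  k : ℕ
  k = suc (suc (suc r))

  G* : Graph (n + suc (suc r)) (m + k)
  G* = attachCycle G v k (s≤s (s≤s (s≤s z≤n)))

  old : Fin n → Fin (n + suc (suc r))
  old x = x ↑ˡ suc (suc r)

  cycleVertex : Fin k → Fin (n + suc (suc r))
  cycleVertex zero    = old v
  cycleVertex (suc j) = n ↑ʳ j

  cycleVertex-injective : Injective _≡_ _≡_ cycleVertex
  cycleVertex-injective {zero}  {zero}  _  = refl
  cycleVertex-injective {zero}  {suc j} eq = ⊥-elim (↑ˡ≢↑ʳ v j eq)
  cycleVertex-injective {suc i} {zero}  eq = ⊥-elim (↑ˡ≢↑ʳ v i (sym eq))
  cycleVertex-injective {suc i} {suc j} eq = cong suc (↑ʳ-injective n i j eq)

  cycleVertex-≢-old : ∀ {x} → v ≢ x → ∀ a → cycleVertex a ≢ old x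
  cycleVertex-≢-old v≢x zero    eq = v≢x (↑ˡ-injective _ v _ eq)
  cycleVertex-≢-old v≢x (suc j) eq = ↑ˡ≢↑ʳ _ j (sym eq)

  G*-old : ∀ i → G* (i ↑ˡ k) ≡ (old (proj₁ (G i)) , old (proj₂ (G i)))
  G*-old i rewrite splitAt-↑ˡ m i k = refl

  G*-cycle : ∀ t → G* (m ↑ʳ t) ≡ (cycleVertex t , cycleVertex (cycleSucc t))
  G*-cycle t rewrite splitAt-↑ʳ m k t = cycleEdges-≡ t
    where
    cycleEdges-≡ : ∀ t → cycleEdges (suc r) v t ≡ (cycleVertex t , cycleVertex (cycleSucc t))
    cycleEdges-≡ zero = refl
    cycleEdges-≡ (suc i) with next i
    ... | just _  = refl
    ... | nothing = refl

  incident-old-old : ∀ x i → incident G* (old x) (i ↑ˡ k) ≡ incident G x i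
  incident-old-old x i = trans (incident-≡ G* (old x) _ (G*-old i))
    (cong₂ _∨_ (does-injective old-injective (proj₁ (G i)) x)
               (does-injective old-injective (proj₂ (G i)) x))
    where
    old-injective : Injective _≡_ _≡_ old
    old-injective = ↑ˡ-injective _ _ _

  incident-new-old : ∀ j i → incident G* (n ↑ʳ j) (i ↑ˡ k) ≡ false
  incident-new-old j i = incident-false G* _ _ (G*-old i) (↑ˡ≢↑ʳ (proj₁ (G i)) j) (↑ˡ≢↑ʳ (proj₂ (G i)) j)

  incident-cycle : ∀ a t → incident G* (cycleVertex a) (m ↑ʳ t) ≡ does (t ≟ a) ∨ does (t ≟ cyclePred a)
  incident-cycle a t = trans (incident-≡ G* _ _ (G*-cycle t))
    (cong₂ _∨_ (does-injective cycleVertex-injective t a)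
               (trans (does-injective cycleVertex-injective (cycleSucc t) a)
                      (does-⇔ cycleSucc≡⇔ (cycleSucc t ≟ a) (t ≟ cyclePred a))))

  incident-cycle-off : ∀ {x} → v ≢ x → ∀ t → incident G* (old x) (m ↑ʳ t) ≡ false
  incident-cycle-off v≢x t = incident-false G* _ _ (G*-cycle t)
    (cycleVertex-≢-old v≢x t) (cycleVertex-≢-old v≢x (cycleSucc t))

  cyclePart : Fin (n + suc (suc r)) → (Fin (m + k) → ℕ) → ℕ
  cyclePart X h = Σᶠ (λ t → if incident G* X (m ↑ʳ t) then h (m ↑ʳ t) else 0)

  incidentSum*-split : ∀ X h → incidentSum G* X h
                 ≡ Σᶠ (λ i → if incident G* X (i ↑ˡ k) then h (i ↑ˡ k) else 0) + cyclePart X h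
  incidentSum*-split X h = Σᶠ-split m k _

  cyclePart-cycleVertex : ∀ a h → cyclePart (cycleVertex a) h ≡ h (m ↑ʳ a) + h (m ↑ʳ cyclePred a)
  cyclePart-cycleVertex a h = trans
    (Σᶠ-cong (λ t → cong (if_then h (m ↑ʳ t) else 0) (incident-cycle a t)))
    (Σᶠ-δ∨δ (h ∘ (m ↑ʳ_)) (cyclePred-≢ a))

  incidentSum*-old : ∀ x h →
    incidentSum G* (old x) h ≡ incidentSum G x (h ∘ (_↑ˡ k)) + cyclePart (old x) h
  incidentSum*-old x h = trans (incidentSum*-split (old x) h) (cong (_+ cyclePart (old x) h)
    (Σᶠ-cong (λ i → cong (if_then h (i ↑ˡ k) else 0) (incident-old-old x i))))

  incidentSum*-other : ∀ {x} → v ≢ x → ∀ h → incidentSum G* (old x) h ≡ incidentSum G x (h ∘ (_↑ˡ k))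
  incidentSum*-other {x} v≢x h = trans (incidentSum*-old x h) (trans
    (cong (incidentSum G x (h ∘ (_↑ˡ k)) +_)
          (Σᶠ-zero (λ t → cong (if_then h (m ↑ʳ t) else 0) (incident-cycle-off v≢x t))))
    (+-identityʳ _))

  incidentSum*-root : ∀ h → incidentSum G* (old v) h
                    ≡ incidentSum G v (h ∘ (_↑ˡ k)) + (h (m ↑ʳ zero) + h (m ↑ʳ cyclePred zero))
  incidentSum*-root h = trans (incidentSum*-old v h)
    (cong (incidentSum G v (h ∘ (_↑ˡ k)) +_) (cyclePart-cycleVertex zero h))

  incidentSum*-new : ∀ j h → incidentSum G* (n ↑ʳ j) h ≡ h (m ↑ʳ suc j) + h (m ↑ʳ cyclePred (suc j))
  incidentSum*-new j h = trans (incidentSum*-split (n ↑ʳ j) h) (trans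
    (cong (_+ cyclePart (n ↑ʳ j) h)
          (Σᶠ-zero (λ i → cong (if_then h (i ↑ˡ k) else 0) (incident-new-old j i))))
    (cyclePart-cycleVertex (suc j) h))

relabel : ∀ {m k} {f : Fin m → Fin m} → Bijective _≡_ _≡_ f → Permutation′ k → Permutation′ (m + k)
relabel {m} {k} f-bij c =
  ↔-trans +↔⊎ (↔-trans (⤖⇒↔ (mk⤖ f-bij) ⊎-cong c)
    (↔-trans swap-↔ (↔-trans (↔-sym +↔⊎) (cast-id (+-comm k m)))))

module _ {m k} {f : Fin m → Fin m} (f-bij : Bijective _≡_ _≡_ f) (c : Permutation′ k) where

  label-relabel-old : ∀ i → label (Inverse.to (relabel f-bij c)) (i ↑ˡ k) ≡ k + label f i
  label-relabel-old i rewrite splitAt-↑ˡ m i k =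
    trans (cong suc (trans (toℕ-cast _ (k ↑ʳ f i)) (toℕ-↑ʳ k (f i)))) (sym (+-suc k _))

  label-relabel-new : ∀ t → label (Inverse.to (relabel f-bij c)) (m ↑ʳ t) ≡ label (Inverse.to c) t
  label-relabel-new t rewrite splitAt-↑ʳ m k t =
    cong suc (trans (toℕ-cast _ (Inverse.to c t ↑ˡ m)) (toℕ-↑ˡ (Inverse.to c t) m))

-- Cycle vertex a lies on the cycle edges a and cyclePred a.
cycleSum : ∀ {k} → (Fin (suc k) → Fin (suc k)) → Fin (suc k) → ℕ
cycleSum c a = label c a + label c (cyclePred a)

cycleSum≤ : ∀ {k} (c : Fin (suc k) → Fin (suc k)) a → cycleSum c a ≤ suc k * 2
cycleSum≤ {k} c a =
  ≤-trans (+-mono-≤ (toℕ<n (c a)) (toℕ<n (c (cyclePred a)))) (≤-reflexive (sym (double (suc k))))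
  where
  double : ∀ x → x * 2 ≡ x + x
  double = solve-∀

AntimagicCycleLabeling : ℕ → Set
AntimagicCycleLabeling k = Σ (Permutation′ (suc k)) (λ c → Injective _≡_ _≡_ (cycleSum (Inverse.to c)))

injective-split : ∀ {N} (g : Fin (suc N) → ℕ) → Injective _≡_ _≡_ (g ∘ suc) →
                  (∀ j → g zero ≢ g (suc j)) → Injective _≡_ _≡_ g
injective-split g g-inj g0≢ {zero}  {zero}  _  = refl
injective-split g g-inj g0≢ {zero}  {suc j} eq = ⊥-elim (g0≢ j eq)
injective-split g g-inj g0≢ {suc i} {zero}  eq = ⊥-elim (g0≢ i (sym eq))
injective-split g g-inj g0≢ {suc i} {suc j} eq = cong suc (g-inj eq)

data Parity : ℕ → Set where
  even : ∀ q → Parity (2 * q)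
  odd  : ∀ q → Parity (suc (2 * q))

parity : ∀ r → Parity r
parity zero = even 0
parity (suc r) with parity r
... | even q = odd q
... | odd q  = subst Parity (*-suc 2 q) (even (suc q))

-- For odd k the identity labelling has sum 2j + 3 at the j-th new vertex and k + 1 (even) at v.
-- For even k these collide; swapping the labels 1 and 2 gives the sums 3, 4 and 2j + 3 (j ≥ 2)
-- at the new vertices and k + 2 (even) at v.
module _ (q : ℕ) where

  private
    σ : Fin (suc (suc (suc (2 * q)))) → Fin (suc (suc (suc (2 * q))))
    σ = Inverse.to id

    σ-sum-zero : cycleSum σ zero ≡ 2 * (2 + q)
    σ-sum-zero = trans (cong (λ t → 2 + t) (toℕ-fromℕ (2 + 2 * q))) (arith q)
      where
      arith : ∀ q → 2 + (2 + 2 * q) ≡ 2 * (2 + q)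
      arith = solve-∀

    σ-sum-suc : ∀ j → cycleSum σ (suc j) ≡ suc (2 * (1 + toℕ j))
    σ-sum-suc j =
      trans (cong (λ t → suc (suc (toℕ j)) + suc t) (toℕ-inject₁ j)) (arith (toℕ j))
      where
      arith : ∀ t → suc (suc t) + suc t ≡ suc (2 * (1 + t))
      arith = solve-∀

  identity-antimagic : Injective _≡_ _≡_ (cycleSum σ)
  identity-antimagic = injective-split (cycleSum σ) sums-injective zero≢suc
    where
    sums-injective : Injective _≡_ _≡_ (cycleSum σ ∘ suc)
    sums-injective {i} {j} eq = toℕ-injective (suc-injective (*-cancelˡ-≡ _ _ 2
      (suc-injective (trans (sym (σ-sum-suc i)) (trans eq (σ-sum-suc j))))))
    zero≢suc : ∀ j → cycleSum σ zero ≢ cycleSum σ (suc j)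
    zero≢suc j eq =
      even≢odd (2 + q) (1 + toℕ j) (trans (sym σ-sum-zero) (trans eq (σ-sum-suc j)))

  private
    τ : Fin (suc (suc (suc (suc (2 * q))))) → Fin (suc (suc (suc (suc (2 * q)))))
    τ = Inverse.to (transpose zero (suc zero))

    τ-sum-zero : cycleSum τ zero ≡ 2 * (3 + q)
    τ-sum-zero = trans (cong (λ t → 2 + suc (suc (suc t))) (toℕ-fromℕ (1 + 2 * q))) (arith q)
      where
      arith : ∀ q → 2 + suc (suc (suc (1 + 2 * q))) ≡ 2 * (3 + q)
      arith = solve-∀

    τ-sum-big : ∀ i → cycleSum τ (suc (suc (suc i))) ≡ suc (2 * (3 + toℕ i))
    τ-sum-big i =
      trans (cong (λ t → 4 + toℕ i + suc (suc (suc t))) (toℕ-inject₁ i)) (arith (toℕ i))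
      where
      arith : ∀ t → 4 + t + suc (suc (suc t)) ≡ suc (2 * (3 + t))
      arith = solve-∀

  transposition-antimagic : Injective _≡_ _≡_ (cycleSum τ)
  transposition-antimagic = injective-split (cycleSum τ) shifted-injective zero≢suc
    where
    3≢big : ∀ i → 3 ≢ cycleSum τ (suc (suc (suc i)))
    3≢big i eq = <⇒≢ (s≤s (s≤s (s≤s (s≤s z≤n)))) (trans eq (τ-sum-big i))
    4≢big : ∀ i → 4 ≢ cycleSum τ (suc (suc (suc i)))
    4≢big i eq = even≢odd 2 (3 + toℕ i) (trans eq (τ-sum-big i))
    shifted-injective : Injective _≡_ _≡_ (cycleSum τ ∘ suc)
    shifted-injective {zero}        {zero}        _  = refl
    shifted-injective {zero}        {suc zero}    ()
    shifted-injective {zero}        {suc (suc j)} eq = ⊥-elim (3≢big j eq)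
    shifted-injective {suc zero}    {zero}        ()
    shifted-injective {suc zero}    {suc zero}    _  = refl
    shifted-injective {suc zero}    {suc (suc j)} eq = ⊥-elim (4≢big j eq)
    shifted-injective {suc (suc i)} {zero}        eq = ⊥-elim (3≢big i (sym eq))
    shifted-injective {suc (suc i)} {suc zero}    eq = ⊥-elim (4≢big i (sym eq))
    shifted-injective {suc (suc i)} {suc (suc j)} eq = cong (λ j → suc (suc j)) (toℕ-injective
      (+-cancelˡ-≡ 3 _ _ (*-cancelˡ-≡ _ _ 2
        (suc-injective (trans (sym (τ-sum-big i)) (trans eq (τ-sum-big j)))))))
    zero≢suc : ∀ j → cycleSum τ zero ≢ cycleSum τ (suc j)
    zero≢suc zero          eq = even≢odd (3 + q) 1 (trans (sym τ-sum-zero) eq)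
    zero≢suc (suc zero)    eq = 0≢1+n (suc-injective (suc-injective
      (*-cancelˡ-≡ 2 (3 + q) 2 (trans (sym eq) τ-sum-zero))))
    zero≢suc (suc (suc i)) eq =
      even≢odd (3 + q) (3 + toℕ i) (trans (sym τ-sum-zero) (trans eq (τ-sum-big i)))

antimagicCycleLabeling : ∀ r → AntimagicCycleLabeling (suc (suc r))
antimagicCycleLabeling r with parity r
... | even q = id , identity-antimagic q
... | odd q  = transpose zero (suc zero) , transposition-antimagic q

module _ (k : ℕ) {d₁ p₁ d₂ p₂ : ℕ} where

  weighted-< : d₁ ≤ d₂ → p₁ < p₂ → k * d₁ + p₁ < k * d₂ + p₂
  weighted-< d₁≤d₂ p₁<p₂ = +-mono-≤-< (*-monoʳ-≤ k d₁≤d₂) p₁<p₂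

  weighted-<-gap : ∀ {a} → a ≤ k * 2 → d₁ + 2 ≤ d₂ → p₁ < p₂ → k * d₁ + p₁ + a < k * d₂ + p₂
  weighted-<-gap {a} a≤2k gap p₁<p₂ = begin-strict
    k * d₁ + p₁ + a      ≡⟨ xy∙z≈xz∙y (k * d₁) p₁ a ⟩
    k * d₁ + a + p₁      <⟨ +-monoʳ-< (k * d₁ + a) p₁<p₂ ⟩
    k * d₁ + a + p₂      ≤⟨ +-monoˡ-≤ p₂ (+-monoʳ-≤ (k * d₁) a≤2k) ⟩
    k * d₁ + k * 2 + p₂  ≡⟨ cong (_+ p₂) (*-distribˡ-+ k d₁ 2) ⟨
    k * (d₁ + 2) + p₂    ≤⟨ +-monoˡ-≤ p₂ (*-monoʳ-≤ k gap) ⟩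
    k * d₂ + p₂          ∎
    where open ≤-Reasoning

module StrongLabeling {n m} (G : Graph n m) (no-leaf : ∀ x → ¬ (deg G x ≡ 1))
                      (f : Fin m → Fin m) (f-strong : IsStronglyAntimagicLabeling G f)
                      (v : Fin n) (gap : DegreeGapAbove G f v)
                      (r : ℕ) (π : Permutation′ (suc (suc (suc r))))
                      (π-antimagic : Injective _≡_ _≡_ (cycleSum (Inverse.to π))) where

  open AttachedCycle G v r

  private
    f-bijective : Bijective _≡_ _≡_ f
    f-bijective = proj₁ (proj₁ f-strong)

    φ-injective : Injective _≡_ _≡_ (φ G f)
    φ-injective = proj₂ (proj₁ f-strong)

    c : Fin k → Fin k
    c = Inverse.to π

  F : Fin (m + k) → Fin (m + k)
  F = Inverse.to (relabel f-bijective π)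

  private
    d p : Fin n → ℕ
    d = deg G
    p = φ G f

    D* Φ* : Fin (n + suc (suc r)) → ℕ
    D* = deg G*
    Φ* = φ G* F

    deg-monotone : ∀ x y → p x < p y → d x ≤ d y
    deg-monotone = strong⇒monotone p d (proj₂ f-strong)

  deg*-other : ∀ {x} → v ≢ x → D* (old x) ≡ d x
  deg*-other v≢x = incidentSum*-other v≢x (λ _ → 1)

  deg*-root : D* (old v) ≡ d v + 2
  deg*-root = incidentSum*-root (λ _ → 1)

  deg*-new : ∀ j → D* (n ↑ʳ j) ≡ 2
  deg*-new j = incidentSum*-new j (λ _ → 1)

  φ*-old-edges : ∀ x → incidentSum G x (label F ∘ (_↑ˡ k)) ≡ k * d x + p x
  φ*-old-edges x = trans (incidentSum-cong G x (label-relabel-old f-bijective π))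
                         (incidentSum-+ G x k (label f))

  φ*-other : ∀ {x} → v ≢ x → Φ* (old x) ≡ k * d x + p x
  φ*-other {x} v≢x = trans (incidentSum*-other v≢x (label F)) (φ*-old-edges x)

  φ*-root : Φ* (old v) ≡ k * d v + p v + cycleSum c zero
  φ*-root = trans (incidentSum*-root (label F)) (cong₂ _+_ (φ*-old-edges v)
    (cong₂ _+_ (label-relabel-new f-bijective π zero)
               (label-relabel-new f-bijective π (cyclePred zero))))

  φ*-new : ∀ j → Φ* (n ↑ʳ j) ≡ cycleSum c (suc j)
  φ*-new j = trans (incidentSum*-new j (label F))
    (cong₂ _+_ (label-relabel-new f-bijective π (suc j))
               (label-relabel-new f-bijective π (cyclePred (suc j))))

  2≤deg : ∀ {x} → d x ≢ 0 → 2 ≤ d x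
  2≤deg {x} dx≢0 with d x | no-leaf x
  ... | zero        | _     = ⊥-elim (dx≢0 refl)
  ... | suc zero    | dx≢1  = ⊥-elim (dx≢1 refl)
  ... | suc (suc _) | _     = s≤s (s≤s z≤n)

  2k<weight : ∀ {x} → d x ≢ 0 → k * 2 < k * d x + p x
  2k<weight {x} dx≢0 = ≤-<-trans (*-monoʳ-≤ k (2≤deg dx≢0))
    (m<m+n (k * d x) (<-≤-trans (n≢0⇒n>0 dx≢0) (deg≤φ G x f)))

  old-order : ∀ x y → p x < p y → Φ* (old x) < Φ* (old y) × D* (old x) ≤ D* (old y)
  old-order x y px<py with v ≟ x | v ≟ y
  ... | yes refl | yes refl = ⊥-elim (<-irrefl refl px<py)
  ... | yes refl | no v≢y rewrite φ*-root | φ*-other v≢y | deg*-root | deg*-other v≢y =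
    weighted-<-gap k (cycleSum≤ c zero) (gap y px<py) px<py , gap y px<py
  ... | no v≢x | yes refl rewrite φ*-other v≢x | φ*-root | deg*-other v≢x | deg*-root =
    <-≤-trans (weighted-< k (deg-monotone x v px<py) px<py) (m≤m+n _ _) ,
    ≤-trans (deg-monotone x v px<py) (m≤m+n (d v) 2)
  ... | no v≢x | no v≢y rewrite φ*-other v≢x | φ*-other v≢y | deg*-other v≢x | deg*-other v≢y =
    weighted-< k (deg-monotone x y px<py) px<py , deg-monotone x y px<py

  data OldShape (x : Fin n) : Set where
    isolated  : D* (old x) ≡ 0 → OldShape x
    bare-root : D* (old x) ≡ 2 → Φ* (old x) ≡ cycleSum c zero → OldShape x
    heavy     : 2 ≤ D* (old x) → k * 2 < Φ* (old x) → OldShape x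

  oldShape : ∀ x → OldShape x
  oldShape x with v ≟ x | d x ℕ.≟ 0
  ... | no v≢x   | yes dx≡0 = isolated (trans (deg*-other v≢x) dx≡0)
  ... | no v≢x   | no dx≢0  = heavy (subst (2 ≤_) (sym (deg*-other v≢x)) (2≤deg dx≢0))
                                    (subst (k * 2 <_) (sym (φ*-other v≢x)) (2k<weight dx≢0))
  ... | yes refl | yes dv≡0 = bare-root (trans deg*-root (cong (_+ 2) dv≡0))
    (trans φ*-root (cong (_+ cycleSum c zero)
      (cong₂ _+_ (trans (cong (k *_) dv≡0) (*-zeroʳ k)) (deg≡0⇒φ≡0 G v f dv≡0))))
  ... | yes refl | no dv≢0  = heavy (subst (2 ≤_) (sym deg*-root) (m≤n+m 2 (d v)))
    (subst (k * 2 <_) (sym φ*-root) (<-≤-trans (2k<weight dv≢0) (m≤m+n _ _)))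

  old≢new : ∀ x j → Φ* (old x) ≢ Φ* (n ↑ʳ j)
  old≢new x j eq with oldShape x
  ... | isolated D≡0   =
    <⇒≢ (s≤s z≤n) (trans (sym (deg≡0⇒φ≡0 G* (old x) F D≡0)) (trans eq (φ*-new j)))
  ... | bare-root _ Φ≡ with () ← π-antimagic (trans (sym Φ≡) (trans eq (φ*-new j)))
  ... | heavy _ 2k<Φ   =
    <⇒≱ 2k<Φ (subst (_≤ k * 2) (sym (trans eq (φ*-new j))) (cycleSum≤ c (suc j)))

  Φ*-injective : Injective _≡_ _≡_ Φ*
  Φ*-injective {X} {Y} eq with split {n} X | split {n} Y
  ... | left x  | right j = ⊥-elim (old≢new x j eq)
  ... | right i | left y  = ⊥-elim (old≢new y i (sym eq))
  ... | right i | right j =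
    cong (n ↑ʳ_) (suc-injective′ (π-antimagic (trans (sym (φ*-new i)) (trans eq (φ*-new j)))))
  ... | left x  | left y with <-cmp (p x) (p y)
  ...   | tri< px<py _ _ = ⊥-elim (<-irrefl eq (proj₁ (old-order x y px<py)))
  ...   | tri≈ _ px≡py _ = cong old (φ-injective px≡py)
  ...   | tri> _ _ py<px = ⊥-elim (<-irrefl (sym eq) (proj₁ (old-order y x py<px)))

  Φ*-monotone : ∀ X Y → Φ* X < Φ* Y → D* X ≤ D* Y
  Φ*-monotone X Y Φ< with split {n} X | split {n} Y
  ... | right i | right j = ≤-reflexive (trans (deg*-new i) (sym (deg*-new j)))
  ... | left x  | right j with oldShape x
  ...   | isolated D≡0    = subst (_≤ D* (n ↑ʳ j)) (sym D≡0) z≤n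
  ...   | bare-root D≡2 _ = ≤-reflexive (trans D≡2 (sym (deg*-new j)))
  ...   | heavy _ 2k<Φ    =
    ⊥-elim (<-asym 2k<Φ (<-≤-trans Φ< (subst (_≤ k * 2) (sym (φ*-new j)) (cycleSum≤ c (suc j)))))
  Φ*-monotone X Y Φ< | right i | left y with oldShape y
  ...   | isolated D≡0    = ⊥-elim (n≮0 (subst (Φ* (n ↑ʳ i) <_) (deg≡0⇒φ≡0 G* (old y) F D≡0) Φ<))
  ...   | bare-root D≡2 _ = ≤-reflexive (trans (deg*-new i) (sym D≡2))
  ...   | heavy 2≤D _     = subst (_≤ D* (old y)) (sym (deg*-new i)) 2≤D
  Φ*-monotone X Y Φ< | left x | left y with <-cmp (p x) (p y)
  ...   | tri< px<py _ _ = proj₂ (old-order x y px<py)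
  ...   | tri≈ _ px≡py _ = ≤-reflexive (cong (D* ∘ old) (φ-injective px≡py))
  ...   | tri> _ _ py<px = ⊥-elim (<-asym Φ< (proj₁ (old-order y x py<px)))

  stronglyAntimagic : StronglyAntimagic G*
  stronglyAntimagic =
    F , (Bijection.bijective (Inverse⇒Bijection (relabel f-bijective π)) , Φ*-injective)
      , monotone⇒strong Φ* D* Φ*-injective Φ*-monotone

corollary2p5 : ∀ {n m} (G : Graph n m) → IsSimple G → (∀ x → ¬ (deg G x ≡ 1)) →
  (f : Fin m → Fin m) → IsStronglyAntimagicLabeling G f →
  (ord : Fin n → Fin n) → Bijective _≡_ _≡_ ord →
  (∀ i i′ → toℕ i < toℕ i′ → φ G f (ord i) < φ G f (ord i′)) →
  (j : Fin n) →
  (suc (toℕ j) ≡ n ⊎ (∀ j′ → toℕ j′ ≡ suc (toℕ j) → deg G (ord j) + 2 ≤ deg G (ord j′))) →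
  (k : ℕ) (3≤k : 3 ≤ k) → StronglyAntimagic (attachCycle G (ord j) k 3≤k)
corollary2p5 G _ no-leaf f f-strong ord ord-bijective ord-mono j gap
             (suc (suc (suc r))) (s≤s (s≤s (s≤s z≤n))) =
  StrongLabeling.stronglyAntimagic G no-leaf f f-strong (ord j)
    (degreeGapAbove G f (proj₂ f-strong) ord (proj₂ ord-bijective) ord-mono gap)
    r (proj₁ (antimagicCycleLabeling r)) (proj₂ (antimagicCycleLabeling r))
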